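{- Let $a>1$ be an integer. If $n$ is an overpseudoprime to base $a$, then every divisor $d>1$ of $n$ satisfies $a^{d-1}\equiv 1\pmod d$.
   Context: For an integer $m>1$ with $\gcd(m,a)=1$, $h_a(m)$ denotes the multiplicative order of $a$ modulo $m$. The cyclotomic cosets of $a$ modulo $m$ are the orbits of $\{1,2,\ldots,m-1\}$ under $x\mapsto ax\bmod m$; $r_a(m)$ denotes their number. An odd composite number $n$ with $\gcd(n,a)=1$ is called an overpseudoprime to base $a$ if $n=r_a(n)h_a(n)+1$. -}

module Defs where

open import Data.Nat using (ℕ; zero; suc; _+_; _*_; _∸_; _^_; _≤_; _<_; _≤?_)
open import Data.Nat.DivMod using (_%_)
open import Data.Nat.Divisibility using (_∣_)
open import Data.Nat.GCD using (gcd)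
open import Data.Nat.Primality using (Composite)
open import Data.Integer as ℤ using (ℤ; +_)
open import Data.Integer.Divisibility using () renaming (_∣_ to _∣ℤ_)
open import Data.List using (List; length; filter; upTo; map)
open import Data.List.Relation.Unary.All using (All; all?)
open import Relation.Binary.PropositionalEquality using (_≡_)
open import Relation.Nullary using (¬_)
open import Data.Product using (_×_)

_≡_[mod_] : ℕ → ℕ → ℕ → Set
x ≡ y [mod m ] = (+ m) ∣ℤ ((+ x) ℤ.- (+ y))

IsMultOrder : ℕ → ℕ → ℕ → Set
IsMultOrder a m h =
  (1 ≤ h) × ((a ^ h) ≡ 1 [mod m ]) × (∀ k → 1 ≤ k → k < h → ¬ ((a ^ k) ≡ 1 [mod m ]))

-- The orbit of x under y ↦ a*y mod m is {a^i x mod m : i ∈ ℕ}; since the map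
-- permutes a set of size < m (for gcd(a,m)=1), i < m covers the whole orbit.
-- x is the representative (least element) of its cyclotomic coset when
-- x ≤ a^i x mod m for all i < m.
-- r_a(m): the number of cyclotomic cosets of a modulo m, counted as the
-- number of coset representatives (least elements) among 1, ..., m-1.
cosetCount : ℕ → ℕ → ℕ
cosetCount a zero = 0
cosetCount a (suc k) =
  length (filter (λ x → all? (λ i → x ≤? ((a ^ i) * x) % suc k) (upTo (suc k)))
                 (map suc (upTo k)))

Odd : ℕ → Set
Odd n = ¬ (2 ∣ n)

IsOverpseudoprime : ℕ → ℕ → Set
IsOverpseudoprime a n =
  Odd n × Composite n × gcd n a ≡ 1 ×
  (∀ h → IsMultOrder a n h → n ≡ cosetCount a n * h + 1)

-- Let h be the order of a modulo n and call the least element of a cyclotomic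
-- coset its leader. Every coset is {aⁱ x mod n : i < h} for its leader x, so the
-- r·h pairs (leader x, i < h) cover all n − 1 nonzero residues; the hypothesis
-- n − 1 = r·h says there are exactly as many pairs as residues, so each
-- residue y is hit exactly once. For d ∣ n, divisibility by q = n/d is
-- invariant under x ↦ a x, and counting the d − 1 nonzero multiples of q
-- through these pairs gives d − 1 = (number of leaders divisible by q)·h.
-- Hence h ∣ d − 1, so a^(d−1) ≡ 1 modulo n and a fortiori modulo d.
module Submission where

open import Defs
open import Data.Nat using (ℕ; _<_; _∸_; _^_)
open import Data.Nat.Divisibility using (_∣_)

open import Data.Nat
  using (zero; suc; _+_; _*_; _≤_; _≤?_; _<?_; _≟_; z≤n; s≤s; z<s; s<s; NonZero; >-nonZero)
open import Data.Nat.Properties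
open import Data.Nat.DivMod
  using (_%_; _/_; m%n<n; m%n%n≡m%n; %-distribˡ-*; m≡m%n+[m/n]*n; m<n⇒m%n≡m; %-remove-+ʳ; n%n≡0)
open import Data.Nat.Divisibility
  using (divides; _∣?_; ∣-refl; ∣-trans; _∣0; ∣⇒≤; ∣m+n∣m⇒∣n; ∣m∣n⇒∣m+n; ∣n⇒∣m*n;
         ∣n∣m%n⇒∣m; %-presˡ-∣; m%n≡0⇒n∣m; n∣m⇒m%n≡0)
open import Data.Nat.Coprimality using (Coprime; coprime-divisor; gcd≡1⇒coprime)
open import Data.Nat.Primality using (¬composite[0])
open import Algebra.Properties.CommutativeSemigroup +-commutativeSemigroup using (interchange)
open import Data.Fin using (toℕ; fromℕ<)
open import Data.Fin.Properties using (pigeonhole; toℕ-fromℕ<)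
open import Data.List using (length; filter; upTo; applyUpTo)
open import Data.List.Properties using (map-applyUpTo)
open import Data.List.Relation.Unary.All using (All; all?)
open import Data.List.Relation.Unary.All.Properties using (applyUpTo⁺₁)
open import Data.Product using (∃; _×_; _,_; proj₂)
open import Data.Sum using (_⊎_; inj₁; inj₂; [_,_]′)
open import Function using (id; _∘_; _⇔_; mk⇔; Equivalence)
open import Relation.Binary.PropositionalEquality
open import Relation.Nullary using (Dec; yes; no; ¬_; contradiction)
open import Relation.Nullary.Decidable using (_×-dec_)
open import Relation.Unary using (Decidable)

𝟙 : {P : Set} → Dec P → ℕ
𝟙 (yes _) = 1
𝟙 (no _)  = 0

𝟙-yes : {P : Set} (P? : Dec P) → P → 𝟙 P? ≡ 1
𝟙-yes (yes _) _  = refl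
𝟙-yes (no ¬p) p = contradiction p ¬p

𝟙-no : {P : Set} (P? : Dec P) → ¬ P → 𝟙 P? ≡ 0
𝟙-no (yes p) ¬p = contradiction p ¬p
𝟙-no (no _)  _  = refl

𝟙-cong : {P Q : Set} (P? : Dec P) (Q? : Dec Q) → P ⇔ Q → 𝟙 P? ≡ 𝟙 Q?
𝟙-cong (yes p) Q? P⇔Q = sym (𝟙-yes Q? (Equivalence.to P⇔Q p))
𝟙-cong (no ¬p) Q? P⇔Q = sym (𝟙-no Q? (¬p ∘ Equivalence.from P⇔Q))

∑< : ℕ → (ℕ → ℕ) → ℕ
∑< zero    g = 0
∑< (suc N) g = g 0 + ∑< N (λ i → g (suc i))

syntax ∑< N (λ i → e) = ∑[ i < N ] e

∑-cong : ∀ N {g g′ : ℕ → ℕ} → (∀ i → i < N → g i ≡ g′ i) → ∑< N g ≡ ∑< N g′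
∑-cong zero    _  = refl
∑-cong (suc N) eq = cong₂ _+_ (eq 0 z<s) (∑-cong N (λ i i<N → eq (suc i) (s<s i<N)))

∑-const : ∀ N c → ∑[ i < N ] c ≡ N * c
∑-const zero    c = refl
∑-const (suc N) c = cong (c +_) (∑-const N c)

∑-zero : ∀ N {g : ℕ → ℕ} → (∀ i → i < N → g i ≡ 0) → ∑< N g ≡ 0
∑-zero N g≡0 = trans (∑-cong N g≡0) (trans (∑-const N 0) (*-zeroʳ N))

∑-distrib-+ : ∀ N (g g′ : ℕ → ℕ) → ∑[ i < N ] (g i + g′ i) ≡ ∑< N g + ∑< N g′
∑-distrib-+ zero    g g′ = refl
∑-distrib-+ (suc N) g g′ =
  trans (cong (g 0 + g′ 0 +_) (∑-distrib-+ N _ _)) (interchange (g 0) (g′ 0) _ _)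

*-distribʳ-∑ : ∀ N (g : ℕ → ℕ) c → ∑< N g * c ≡ ∑[ i < N ] (g i * c)
*-distribʳ-∑ zero    g c = refl
*-distribʳ-∑ (suc N) g c =
  trans (*-distribʳ-+ c (g 0) _) (cong (g 0 * c +_) (*-distribʳ-∑ N _ c))

∑-comm : ∀ N M (g : ℕ → ℕ → ℕ) →
         ∑[ i < N ] ∑[ j < M ] g i j ≡ ∑[ j < M ] ∑[ i < N ] g i j
∑-comm zero    M g = sym (∑-zero M (λ _ _ → refl))
∑-comm (suc N) M g =
  trans (cong (∑[ j < M ] g 0 j +_) (∑-comm N M _)) (sym (∑-distrib-+ M _ _))

∑-split : ∀ A B (g : ℕ → ℕ) → ∑< (A + B) g ≡ ∑< A g + ∑[ i < B ] g (A + i)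
∑-split zero    B g = refl
∑-split (suc A) B g = trans (cong (g 0 +_) (∑-split A B _)) (sym (+-assoc (g 0) _ _))

term≤∑ : ∀ N (g : ℕ → ℕ) {i} → i < N → g i ≤ ∑< N g
term≤∑ (suc N) g {zero}  _         = m≤m+n (g 0) _
term≤∑ (suc N) g {suc i} (s<s i<N) = ≤-trans (term≤∑ N _ i<N) (m≤n+m _ (g 0))

N≤∑ : ∀ N {g : ℕ → ℕ} → (∀ i → i < N → 0 < g i) → N ≤ ∑< N g
N≤∑ zero    _   = z≤n
N≤∑ (suc N) pos = +-mono-≤ (pos 0 z<s) (N≤∑ N (λ i i<N → pos (suc i) (s<s i<N)))

∑≡N⇒≡1 : ∀ N {g : ℕ → ℕ} → (∀ i → i < N → 0 < g i) → ∑< N g ≡ N → ∀ i → i < N → g i ≡ 1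
∑≡N⇒≡1 (suc N) {g} pos ∑≡1+N = λ where
    zero    _         → g0≡1
    (suc i) (s<s i<N) → ∑≡N⇒≡1 N pos′ rest≡N i i<N
  where
  pos′ : ∀ i → i < N → 0 < g (suc i)
  pos′ i i<N = pos (suc i) (s<s i<N)

  rest : ℕ
  rest = ∑[ i < N ] g (suc i)

  g0≡1 : g 0 ≡ 1
  g0≡1 = ≤-antisym (+-cancelʳ-≤ N (g 0) 1 (begin
    g 0 + N    ≤⟨ +-monoʳ-≤ (g 0) (N≤∑ N pos′) ⟩
    g 0 + rest ≡⟨ ∑≡1+N ⟩
    1 + N      ∎)) (pos 0 z<s)
    where open ≤-Reasoning

  rest≡N : rest ≡ N
  rest≡N = suc-injective (trans (cong (_+ rest) (sym g0≡1)) ∑≡1+N)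

∑-δ : ∀ M {c} (w : ℕ → ℕ) → c < M → ∑[ y < M ] (𝟙 (c ≟ y) * w y) ≡ w c
∑-δ (suc M) {zero} w _ = begin
  𝟙 (0 ≟ 0) * w 0 + ∑[ y < M ] (𝟙 (0 ≟ suc y) * w (suc y))
    ≡⟨ cong₂ _+_ (cong (_* w 0) (𝟙-yes (0 ≟ 0) refl))
                 (∑-zero M (λ y _ → cong (_* w (suc y)) (𝟙-no (0 ≟ suc y) λ ()))) ⟩
  1 * w 0 + 0
    ≡⟨ trans (+-identityʳ _) (*-identityˡ _) ⟩
  w 0 ∎
  where open ≡-Reasoning
∑-δ (suc M) {suc c} w (s<s c<M) = begin
  𝟙 (suc c ≟ 0) * w 0 + ∑[ y < M ] (𝟙 (suc c ≟ suc y) * w (suc y))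
    ≡⟨ cong₂ _+_ (cong (_* w 0) (𝟙-no (suc c ≟ 0) λ ()))
                 (∑-cong M (λ y _ → cong (_* w (suc y)) (𝟙-cong (suc c ≟ suc y) (c ≟ y)
                   (mk⇔ suc-injective (cong suc))))) ⟩
  ∑[ y < M ] (𝟙 (c ≟ y) * w (suc y))
    ≡⟨ ∑-δ M (λ y → w (suc y)) c<M ⟩
  w (suc c) ∎
  where open ≡-Reasoning

∑-fibres : ∀ N H M (f : ℕ → ℕ → ℕ) (W : ℕ → ℕ → ℕ) → (∀ i x → f i x < M) →
           ∑[ x < N ] ∑[ i < H ] W x (f i x)
             ≡ ∑[ y < M ] ∑[ x < N ] ∑[ i < H ] (𝟙 (f i x ≟ y) * W x y)
∑-fibres N H M f W f<M = begin
  ∑[ x < N ] ∑[ i < H ] W x (f i x)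
    ≡⟨ ∑-cong N (λ x _ → ∑-cong H (λ i _ → sym (∑-δ M (W x) (f<M i x)))) ⟩
  ∑[ x < N ] ∑[ i < H ] ∑[ y < M ] (𝟙 (f i x ≟ y) * W x y)
    ≡⟨ ∑-cong N (λ x _ → ∑-comm H M _) ⟩
  ∑[ x < N ] ∑[ y < M ] ∑[ i < H ] (𝟙 (f i x ≟ y) * W x y)
    ≡⟨ ∑-comm N M _ ⟩
  ∑[ y < M ] ∑[ x < N ] ∑[ i < H ] (𝟙 (f i x ≟ y) * W x y) ∎
  where open ≡-Reasoning

length-filter≡∑𝟙 : ∀ {P : ℕ → Set} (P? : Decidable P) N (g : ℕ → ℕ) →
                   length (filter P? (applyUpTo g N)) ≡ ∑[ i < N ] 𝟙 (P? (g i))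
length-filter≡∑𝟙 P? zero    g = refl
length-filter≡∑𝟙 P? (suc N) g with P? (g 0)
... | yes _ = cong suc (length-filter≡∑𝟙 P? N (g ∘ suc))
... | no  _ = length-filter≡∑𝟙 P? N (g ∘ suc)

∑-multiples : ∀ d q .{{_ : NonZero q}} → ∑[ y < d * q ] 𝟙 (q ∣? y) ≡ d
∑-multiples zero    q = refl
∑-multiples (suc d) q = begin
  ∑[ y < q + d * q ] 𝟙 (q ∣? y)
    ≡⟨ ∑-split q (d * q) _ ⟩
  ∑[ y < q ] 𝟙 (q ∣? y) + ∑[ y < d * q ] 𝟙 (q ∣? (q + y))
    ≡⟨ cong₂ _+_ (first-block q) (∑-cong (d * q) (λ y _ → 𝟙-cong (q ∣? (q + y)) (q ∣? y)
         (mk⇔ (λ q∣q+y → ∣m+n∣m⇒∣n q∣q+y ∣-refl) (∣m∣n⇒∣m+n ∣-refl)))) ⟩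
  1 + ∑[ y < d * q ] 𝟙 (q ∣? y)
    ≡⟨ cong suc (∑-multiples d q) ⟩
  suc d ∎
  where
  open ≡-Reasoning
  first-block : ∀ q .{{_ : NonZero q}} → ∑[ y < q ] 𝟙 (q ∣? y) ≡ 1
  first-block (suc q) = cong₂ _+_ (𝟙-yes (suc q ∣? 0) (suc q ∣0))
    (∑-zero q (λ y y<q → 𝟙-no (suc q ∣? suc y) (λ q∣ → <⇒≱ (s<s y<q) (∣⇒≤ q∣))))

[m%n]*o%n≡m*o%n : ∀ m o n .{{_ : NonZero n}} → (m % n * o) % n ≡ (m * o) % n
[m%n]*o%n≡m*o%n m o n = begin
  (m % n * o) % n             ≡⟨ %-distribˡ-* (m % n) o n ⟩
  (m % n % n * (o % n)) % n   ≡⟨ cong (λ z → (z * (o % n)) % n) (m%n%n≡m%n m n) ⟩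
  (m % n * (o % n)) % n       ≡⟨ %-distribˡ-* m o n ⟨
  (m * o) % n                 ∎
  where open ≡-Reasoning

m*[o%n]%n≡m*o%n : ∀ m o n .{{_ : NonZero n}} → (m * (o % n)) % n ≡ (m * o) % n
m*[o%n]%n≡m*o%n m o n = begin
  (m * (o % n)) % n ≡⟨ cong (_% n) (*-comm m (o % n)) ⟩
  (o % n * m) % n   ≡⟨ [m%n]*o%n≡m*o%n o m n ⟩
  (o * m) % n       ≡⟨ cong (_% n) (*-comm o m) ⟩
  (m * o) % n       ∎
  where open ≡-Reasoning

%≡%⇒∣∸ : ∀ x y m .{{_ : NonZero m}} → x % m ≡ y % m → m ∣ x ∸ y
%≡%⇒∣∸ x y m x≡y = divides (x / m ∸ y / m) (begin
  x ∸ y                                     ≡⟨ cong₂ _∸_ (m≡m%n+[m/n]*n x m) (m≡m%n+[m/n]*n y m) ⟩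
  (x % m + x / m * m) ∸ (y % m + y / m * m) ≡⟨ cong (λ z → (z + x / m * m) ∸ (y % m + y / m * m)) x≡y ⟩
  (y % m + x / m * m) ∸ (y % m + y / m * m) ≡⟨ [m+n]∸[m+o]≡n∸o (y % m) _ _ ⟩
  x / m * m ∸ y / m * m                     ≡⟨ *-distribʳ-∸ m (x / m) (y / m) ⟨
  (x / m ∸ y / m) * m                       ∎)
  where open ≡-Reasoning

∣∸⇒%≡% : ∀ {x y} m .{{_ : NonZero m}} → y ≤ x → m ∣ x ∸ y → x % m ≡ y % m
∣∸⇒%≡% {x} {y} m y≤x m∣x∸y = begin
  x % m             ≡⟨ cong (_% m) (m+[n∸m]≡n y≤x) ⟨
  (y + (x ∸ y)) % m ≡⟨ %-remove-+ʳ y m∣x∸y ⟩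
  y % m             ∎
  where open ≡-Reasoning

≡1[mod]⇔∣∸1 : ∀ {m x} → 1 ≤ x → x ≡ 1 [mod m ] ⇔ m ∣ x ∸ 1
≡1[mod]⇔∣∸1 (s≤s z≤n) = mk⇔ id id

coprime-∣ˡ : ∀ {d m n} → d ∣ m → Coprime m n → Coprime d n
coprime-∣ˡ d∣m m⊥n (c∣d , c∣n) = m⊥n (∣-trans c∣d d∣m , c∣n)

coprime-pow-divisor : ∀ {m a} → Coprime m a → ∀ i {x} → m ∣ a ^ i * x → m ∣ x
coprime-pow-divisor         m⊥a zero    {x} m∣ = subst (_ ∣_) (+-identityʳ x) m∣
coprime-pow-divisor {m} {a} m⊥a (suc i) {x} m∣ =
  coprime-pow-divisor m⊥a i (coprime-divisor m⊥a (subst (m ∣_) (*-assoc a (a ^ i) x) m∣))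

least-witness : ∀ {P : ℕ → Set} → Decidable P → ∀ {K} → P K →
                ∃ λ t → P t × (∀ s → s < t → ¬ P s)
least-witness {P} P? {K} PK =
  [ (λ none → contradiction PK (none K (n<1+n K))) , id ]′ (search (suc K))
  where
  search : ∀ B → (∀ s → s < B → ¬ P s) ⊎ (∃ λ t → P t × (∀ s → s < t → ¬ P s))
  search zero = inj₁ (λ _ ())
  search (suc B) with search B | P? B
  ... | inj₂ least | _      = inj₂ least
  ... | inj₁ none  | yes PB = inj₂ (B , PB , none)
  ... | inj₁ none  | no ¬PB = inj₁ λ s s<1+B →
        [ none s , (λ { refl → ¬PB }) ]′ (m<1+n⇒m<n∨m≡n s<1+B)

argmin : ∀ N .{{_ : NonZero N}} (o : ℕ → ℕ) → ∃ λ j → j < N × (∀ i → i < N → o j ≤ o i)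
argmin (suc zero)    o = 0 , z<s , λ { zero _ → ≤-refl ; (suc i) (s<s ()) }
argmin (suc (suc N)) o with j , j<1+N , j-min ← argmin (suc N) o | o j ≤? o (suc N)
... | yes oj≤ = j , m<n⇒m<1+n j<1+N , λ i i<2+N →
      [ j-min i , (λ { refl → oj≤ }) ]′ (m<1+n⇒m<n∨m≡n i<2+N)
... | no  oj≰ = suc N , n<1+n _ , λ i i<2+N →
      [ (λ i<1+N → ≤-trans (<⇒≤ (≰⇒> oj≰)) (j-min i i<1+N)) , (λ { refl → ≤-refl }) ]′
        (m<1+n⇒m<n∨m≡n i<2+N)

pow-recurrent : ∀ {n a} .{{_ : NonZero n}} .{{_ : NonZero a}} → Coprime n a →
                ∃ λ t → 0 < t × a ^ t % n ≡ 1 % n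
pow-recurrent {n} {a} n⊥a
  with i , j , i<j , fi≡fj ← pigeonhole (n<1+n n) (λ i → fromℕ< (m%n<n (a ^ toℕ i) n)) =
  e , m<n⇒0<n∸m i<j , ∣∸⇒%≡% n (m^n>0 a e) (coprime-pow-divisor n⊥a (toℕ i) n∣a^i*[a^e∸1])
  where
  open ≡-Reasoning
  e : ℕ
  e = toℕ j ∸ toℕ i

  a^i≡a^j : a ^ toℕ i % n ≡ a ^ toℕ j % n
  a^i≡a^j = trans (sym (toℕ-fromℕ< _)) (trans (cong toℕ fi≡fj) (toℕ-fromℕ< _))

  n∣a^i*[a^e∸1] : n ∣ a ^ toℕ i * (a ^ e ∸ 1)
  n∣a^i*[a^e∸1] = subst (n ∣_) (begin
    a ^ toℕ j ∸ a ^ toℕ i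
      ≡⟨ cong (λ k → a ^ k ∸ a ^ toℕ i) (m+[n∸m]≡n (<⇒≤ i<j)) ⟨
    a ^ (toℕ i + e) ∸ a ^ toℕ i
      ≡⟨ cong₂ _∸_ (^-distribˡ-+-* a (toℕ i) e) (sym (*-identityʳ (a ^ toℕ i))) ⟩
    a ^ toℕ i * a ^ e ∸ a ^ toℕ i * 1
      ≡⟨ *-distribˡ-∸ (a ^ toℕ i) (a ^ e) 1 ⟨
    a ^ toℕ i * (a ^ e ∸ 1) ∎)
    (%≡%⇒∣∸ (a ^ toℕ j) (a ^ toℕ i) n (sym a^i≡a^j))

multOrder : ∀ {n a} .{{_ : NonZero n}} .{{_ : NonZero a}} → Coprime n a → ∃ (IsMultOrder a n)
multOrder {n} {a} n⊥a
  with h , (0<h , a^h≡1) , minimal ←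
       least-witness (λ t → 0 <? t ×-dec (a ^ t % n ≟ 1 % n)) (proj₂ (pow-recurrent n⊥a)) =
  h , 0<h , from≡1 h a^h≡1 , λ s 0<s s<h a^s≡1 → minimal s s<h (0<s , to≡1 s a^s≡1)
  where
  from≡1 : ∀ t → a ^ t % n ≡ 1 % n → (a ^ t) ≡ 1 [mod n ]
  from≡1 t = Equivalence.from (≡1[mod]⇔∣∸1 (m^n>0 a t)) ∘ %≡%⇒∣∸ (a ^ t) 1 n
  to≡1 : ∀ t → (a ^ t) ≡ 1 [mod n ] → a ^ t % n ≡ 1 % n
  to≡1 t = ∣∸⇒%≡% n (m^n>0 a t) ∘ Equivalence.to (≡1[mod]⇔∣∸1 (m^n>0 a t))

module PowerAction (n a : ℕ) .{{_ : NonZero n}} where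

  act : ℕ → ℕ → ℕ
  act i x = a ^ i * x % n

  act-< : ∀ i x → act i x < n
  act-< i x = m%n<n (a ^ i * x) n

  act-0 : ∀ {x} → x < n → act 0 x ≡ x
  act-0 {x} x<n = trans (cong (_% n) (*-identityˡ x)) (m<n⇒m%n≡m x<n)

  act-+ : ∀ i j x → act i (act j x) ≡ act (i + j) x
  act-+ i j x = begin
    a ^ i * (a ^ j * x % n) % n ≡⟨ m*[o%n]%n≡m*o%n (a ^ i) (a ^ j * x) n ⟩
    a ^ i * (a ^ j * x) % n     ≡⟨ cong (_% n) (*-assoc (a ^ i) (a ^ j) x) ⟨
    a ^ i * a ^ j * x % n       ≡⟨ cong (λ z → z * x % n) (^-distribˡ-+-* a i j) ⟨
    a ^ (i + j) * x % n         ∎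
    where open ≡-Reasoning

  act≢0 : Coprime n a → ∀ i {x} → 0 < x → x < n → act i x ≢ 0
  act≢0 n⊥a i {x} 0<x x<n act≡0 =
    <⇒≱ x<n (∣⇒≤ {{>-nonZero 0<x}} (coprime-pow-divisor n⊥a i (m%n≡0⇒n∣m _ n act≡0)))

  ∣act⇔∣ : ∀ {q} → q ∣ n → Coprime q a → ∀ i {x} → q ∣ act i x ⇔ q ∣ x
  ∣act⇔∣ q∣n q⊥a i = mk⇔
    (coprime-pow-divisor q⊥a i ∘ ∣n∣m%n⇒∣m q∣n)
    (λ q∣x → %-presˡ-∣ (∣n⇒∣m*n (a ^ i) q∣x) q∣n)

  module Periodic (h : ℕ) .{{_ : NonZero h}} (a^h≡1 : a ^ h % n ≡ 1 % n) where

    ^-+-period : ∀ s → a ^ (h + s) % n ≡ a ^ s % n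
    ^-+-period s = begin
      a ^ (h + s) % n         ≡⟨ cong (_% n) (^-distribˡ-+-* a h s) ⟩
      a ^ h * a ^ s % n       ≡⟨ [m%n]*o%n≡m*o%n (a ^ h) (a ^ s) n ⟨
      a ^ h % n * a ^ s % n   ≡⟨ cong (λ z → z * a ^ s % n) a^h≡1 ⟩
      1 % n * a ^ s % n       ≡⟨ [m%n]*o%n≡m*o%n 1 (a ^ s) n ⟩
      1 * a ^ s % n           ≡⟨ cong (_% n) (*-identityˡ (a ^ s)) ⟩
      a ^ s % n               ∎
      where open ≡-Reasoning

    ^-*-period : ∀ q s → a ^ (q * h + s) % n ≡ a ^ s % n
    ^-*-period zero    s = refl
    ^-*-period (suc q) s = trans (cong (λ e → a ^ e % n) (+-assoc h (q * h) s))
                                 (trans (^-+-period (q * h + s)) (^-*-period q s))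

    ^-%-period : ∀ t → a ^ t % n ≡ a ^ (t % h) % n
    ^-%-period t = trans
      (cong (λ e → a ^ e % n) (trans (m≡m%n+[m/n]*n t h) (+-comm (t % h) _)))
      (^-*-period (t / h) (t % h))

    ^-multiple : ∀ {t} → h ∣ t → a ^ t % n ≡ 1 % n
    ^-multiple {t} h∣t = trans (^-%-period t) (cong (λ e → a ^ e % n) (n∣m⇒m%n≡0 t h h∣t))

    act-% : ∀ t x → act t x ≡ act (t % h) x
    act-% t x = begin
      a ^ t * x % n           ≡⟨ [m%n]*o%n≡m*o%n (a ^ t) x n ⟨
      a ^ t % n * x % n       ≡⟨ cong (λ z → z * x % n) (^-%-period t) ⟩
      a ^ (t % h) % n * x % n ≡⟨ [m%n]*o%n≡m*o%n (a ^ (t % h)) x n ⟩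
      a ^ (t % h) * x % n     ∎
      where open ≡-Reasoning

    act-inverse : ∀ {j} y → j < h → y < n → act ((h ∸ j) % h) (act j y) ≡ y
    act-inverse {j} y j<h y<n = begin
      act ((h ∸ j) % h) (act j y) ≡⟨ act-% (h ∸ j) (act j y) ⟨
      act (h ∸ j) (act j y)       ≡⟨ act-+ (h ∸ j) j y ⟩
      act (h ∸ j + j) y           ≡⟨ cong (λ e → act e y) (m∸n+n≡m (<⇒≤ j<h)) ⟩
      act h y                     ≡⟨ act-% h y ⟩
      act (h % h) y               ≡⟨ cong (λ e → act e y) (n%n≡0 h) ⟩
      act 0 y                     ≡⟨ act-0 y<n ⟩
      y                           ∎
      where open ≡-Reasoning

module CosetLeaders (k a : ℕ) (n⊥a : Coprime (suc k) a) where

  private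
    n : ℕ
    n = suc k

  open PowerAction n a

  minimal? : ∀ x → Dec (All (λ i → x ≤ act i x) (upTo n))
  minimal? x = all? (λ i → x ≤? act i x) (upTo n)

  leader : ℕ → ℕ
  leader zero    = 0
  leader (suc x) = 𝟙 (minimal? (suc x))

  cosetCount≡∑leader : cosetCount a n ≡ ∑< n leader
  cosetCount≡∑leader = trans (cong (length ∘ filter minimal?) (map-applyUpTo id suc k))
                             (length-filter≡∑𝟙 minimal? k suc)

  leader-minimal : ∀ {x} → 0 < x → (∀ i → i < n → x ≤ act i x) → leader x ≡ 1
  leader-minimal {suc x} _ x-min =
    𝟙-yes (minimal? (suc x)) (applyUpTo⁺₁ id n (λ {i} i<n → x-min i i<n))

  module _ (h : ℕ) .{{_ : NonZero h}} (a^h≡1 : a ^ h % n ≡ 1 % n)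
           (leaders*h≡k : ∑< n leader * h ≡ k) where

    open Periodic h a^h≡1

    preimages : ℕ → ℕ
    preimages y = ∑[ x < n ] ∑[ i < h ] (𝟙 (act i x ≟ y) * leader x)

    ∑-orbit-invariant : ∀ (V : ℕ → ℕ) → (∀ i x → V (act i x) ≡ V x) →
                        ∑[ x < n ] (leader x * V x) * h ≡ ∑[ y < n ] (preimages y * V y)
    ∑-orbit-invariant V V-inv = begin
      ∑[ x < n ] (leader x * V x) * h
        ≡⟨ *-distribʳ-∑ n (λ x → leader x * V x) h ⟩
      ∑[ x < n ] (leader x * V x * h)
        ≡⟨ ∑-cong n (λ x _ → trans (*-comm (leader x * V x) h) (sym (∑-const h (leader x * V x)))) ⟩
      ∑[ x < n ] ∑[ i < h ] (leader x * V x)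
        ≡⟨ ∑-cong n (λ x _ → ∑-cong h (λ i _ → cong (leader x *_) (sym (V-inv i x)))) ⟩
      ∑[ x < n ] ∑[ i < h ] (leader x * V (act i x))
        ≡⟨ ∑-fibres n h n act (λ x y → leader x * V y) act-< ⟩
      ∑[ y < n ] ∑[ x < n ] ∑[ i < h ] (𝟙 (act i x ≟ y) * (leader x * V y))
        ≡⟨ ∑-cong n (λ y _ → ∑-cong n (λ x _ → ∑-cong h (λ i _ → sym (*-assoc (𝟙 (act i x ≟ y)) (leader x) (V y))))) ⟩
      ∑[ y < n ] ∑[ x < n ] ∑[ i < h ] (𝟙 (act i x ≟ y) * leader x * V y)
        ≡⟨ ∑-cong n (λ y _ → trans
             (∑-cong n (λ x _ → sym (*-distribʳ-∑ h (λ i → 𝟙 (act i x ≟ y) * leader x) (V y))))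
             (sym (*-distribʳ-∑ n (λ x → ∑[ i < h ] (𝟙 (act i x ≟ y) * leader x)) (V y)))) ⟩
      ∑[ y < n ] (preimages y * V y) ∎
      where open ≡-Reasoning

    preimages-0 : preimages 0 ≡ 0
    preimages-0 = ∑-zero n (λ x x<n → ∑-zero h (λ i _ → unreachable x x<n i))
      where
      unreachable : ∀ x → x < n → ∀ i → 𝟙 (act i x ≟ 0) * leader x ≡ 0
      unreachable zero    _   i = *-zeroʳ (𝟙 (act i 0 ≟ 0))
      unreachable (suc x) x<n i =
        cong (_* leader (suc x)) (𝟙-no (act i (suc x) ≟ 0) (act≢0 n⊥a i z<s x<n))

    orbit-minimum-leader : ∀ {y j₀} → 0 < y → y < n → (∀ j → j < h → act j₀ y ≤ act j y) →
                           leader (act j₀ y) ≡ 1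
    orbit-minimum-leader {y} {j₀} 0<y y<n j₀-min =
      leader-minimal (n≢0⇒n>0 (act≢0 n⊥a j₀ 0<y y<n)) λ i _ → begin
        act j₀ y             ≤⟨ j₀-min ((i + j₀) % h) (m%n<n (i + j₀) h) ⟩
        act ((i + j₀) % h) y ≡⟨ act-% (i + j₀) y ⟨
        act (i + j₀) y       ≡⟨ act-+ i j₀ y ⟨
        act i (act j₀ y)     ∎
      where open ≤-Reasoning

    preimages-pos : ∀ {y} → 0 < y → y < n → 0 < preimages y
    preimages-pos {y} 0<y y<n with j₀ , j₀<h , j₀-min ← argmin h (λ j → act j y) = begin
      1
        ≡⟨ cong₂ _*_ (𝟙-yes (act i₀ x₀ ≟ y) (act-inverse y j₀<h y<n))
                     (orbit-minimum-leader {j₀ = j₀} 0<y y<n j₀-min) ⟨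
      𝟙 (act i₀ x₀ ≟ y) * leader x₀
        ≤⟨ term≤∑ h (λ i → 𝟙 (act i x₀ ≟ y) * leader x₀) (m%n<n (h ∸ j₀) h) ⟩
      ∑[ i < h ] (𝟙 (act i x₀ ≟ y) * leader x₀)
        ≤⟨ term≤∑ n (λ x → ∑[ i < h ] (𝟙 (act i x ≟ y) * leader x)) (act-< j₀ y) ⟩
      preimages y ∎
      where
      open ≤-Reasoning
      x₀ i₀ : ℕ
      x₀ = act j₀ y
      i₀ = (h ∸ j₀) % h

    ∑-preimages : ∑< n preimages ≡ k
    ∑-preimages = begin
      ∑< n preimages                ≡⟨ ∑-cong n (λ y _ → *-identityʳ (preimages y)) ⟨
      ∑[ y < n ] (preimages y * 1)  ≡⟨ ∑-orbit-invariant (λ _ → 1) (λ _ _ → refl) ⟨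
      ∑[ x < n ] (leader x * 1) * h ≡⟨ cong (_* h) (∑-cong n (λ x _ → *-identityʳ (leader x))) ⟩
      ∑< n leader * h               ≡⟨ leaders*h≡k ⟩
      k                             ∎
      where open ≡-Reasoning

    preimages-1 : ∀ {y} → 0 < y → y < n → preimages y ≡ 1
    preimages-1 {suc u} _ (s<s u<k) = ∑≡N⇒≡1 k (λ v v<k → preimages-pos z<s (s<s v<k))
      (trans (cong (_+ ∑[ v < k ] preimages (suc v)) (sym preimages-0)) ∑-preimages) u u<k

    ∑-preimages-weighted : ∀ (V : ℕ → ℕ) → ∑[ y < n ] (preimages y * V y) ≡ ∑[ u < k ] V (suc u)
    ∑-preimages-weighted V = begin
      preimages 0 * V 0 + ∑[ u < k ] (preimages (suc u) * V (suc u))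
        ≡⟨ cong₂ _+_ (cong (_* V 0) preimages-0) (∑-cong k (λ u u<k →
             trans (cong (_* V (suc u)) (preimages-1 z<s (s<s u<k))) (*-identityˡ (V (suc u))))) ⟩
      0 * V 0 + ∑[ u < k ] V (suc u) ∎
      where open ≡-Reasoning

    order∣divisor∸1 : ∀ {d} → d ∣ n → h ∣ d ∸ 1
    order∣divisor∸1 {d} (divides (suc q′) n≡qd) = divides (∑[ x < n ] (leader x * D x)) (begin
      d ∸ 1                              ≡⟨ cong (_∸ 1) (∑-multiples d q) ⟨
      ∑[ y < d * q ] D y ∸ 1             ≡⟨ cong (λ m → ∑< m D ∸ 1) (trans (*-comm d q) (sym n≡qd)) ⟩
      (D 0 + ∑[ u < k ] D (suc u)) ∸ 1   ≡⟨ cong (λ z → (z + ∑[ u < k ] D (suc u)) ∸ 1) (𝟙-yes (q ∣? 0) (q ∣0)) ⟩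
      ∑[ u < k ] D (suc u)               ≡⟨ ∑-preimages-weighted D ⟨
      ∑[ y < n ] (preimages y * D y)     ≡⟨ ∑-orbit-invariant D D-invariant ⟨
      ∑[ x < n ] (leader x * D x) * h    ∎)
      where
      open ≡-Reasoning
      q : ℕ
      q = suc q′
      q∣n : q ∣ n
      q∣n = divides d (trans n≡qd (*-comm q d))
      D : ℕ → ℕ
      D y = 𝟙 (q ∣? y)
      D-invariant : ∀ i x → D (act i x) ≡ D x
      D-invariant i x = 𝟙-cong (q ∣? act i x) (q ∣? x) (∣act⇔∣ q∣n (coprime-∣ˡ q∣n n⊥a) i)

    ^-divisor∸1 : ∀ {d} → d ∣ n → a ^ (d ∸ 1) % n ≡ 1 % n
    ^-divisor∸1 = ^-multiple ∘ order∣divisor∸1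

fermat-divisors : ∀ {k a h} .{{_ : NonZero a}} → Coprime (suc k) a → 0 < h →
                  (a ^ h) ≡ 1 [mod suc k ] → suc k ≡ cosetCount a (suc k) * h + 1 →
                  ∀ {d} → d ∣ suc k → (a ^ (d ∸ 1)) ≡ 1 [mod d ]
fermat-divisors {k} {a} {h} n⊥a 0<h a^h≡1 n≡rh+1 {d} d∣n =
  Equivalence.from (≡1[mod]⇔∣∸1 (m^n>0 a (d ∸ 1))) (∣-trans d∣n n∣a^[d∸1]∸1)
  where
  open CosetLeaders k a n⊥a
  n : ℕ
  n = suc k
  instance
    h≢0 : NonZero h
    h≢0 = >-nonZero 0<h

  leaders*h≡k : ∑< n leader * h ≡ k
  leaders*h≡k = suc-injective (begin
    suc (∑< n leader * h)  ≡⟨ +-comm 1 (∑< n leader * h) ⟩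
    ∑< n leader * h + 1    ≡⟨ cong (λ r → r * h + 1) cosetCount≡∑leader ⟨
    cosetCount a n * h + 1 ≡⟨ n≡rh+1 ⟨
    n                      ∎)
    where open ≡-Reasoning

  n∣a^[d∸1]∸1 : n ∣ a ^ (d ∸ 1) ∸ 1
  n∣a^[d∸1]∸1 = %≡%⇒∣∸ (a ^ (d ∸ 1)) 1 n (^-divisor∸1 h
    (∣∸⇒%≡% n (m^n>0 a h) (Equivalence.to (≡1[mod]⇔∣∸1 (m^n>0 a h)) a^h≡1)) leaders*h≡k d∣n)

theorem13 : (a n : ℕ) → 1 < a → IsOverpseudoprime a n →
    ∀ d → 1 < d → d ∣ n → (a ^ (d ∸ 1)) ≡ 1 [mod d ]
theorem13 zero    _       ()
theorem13 (suc _) zero    _ (_ , composite , _) = contradiction composite ¬composite[0]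
theorem13 (suc a) (suc k) _ (_ , _ , gcd≡1 , overpseudoprime) d _ =
  let h , order = multOrder n⊥a
      0<h , a^h≡1 , _ = order
  in  fermat-divisors n⊥a 0<h a^h≡1 (overpseudoprime h order)
  where
  n⊥a : Coprime (suc k) (suc a)
  n⊥a = gcd≡1⇒coprime gcd≡1
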